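{- For integers $m,n\geq 0$ and $q\geq 0$, the $(q+1)$-flags of $\Gamma^+(m,n)$ are in bijection with the $q$-Delannoy paths from $(0,0)$ to $(m,n)$.
   Context: Let $X=\{x_1,\dots,x_m\}$, $Y=\{y_1,\dots,y_n\}$, $\mathcal E(X,Y)=\{\{x,y\}:x\in X,y\in Y\}$. The complex $\Gamma^+(m,n)$ is the simplicial complex on vertex set $\mathcal E(X,Y)$ whose faces are the sets $\sigma$ of edges such that each letter lies in at most one edge of $\sigma$, and if $\{x_{s_1},y_{t_1}\},\{x_{s_2},y_{t_2}\}\in\sigma$ with $s_1<s_2$ then $t_1<t_2$. A $(q+1)$-flag of $\Gamma^+(m,n)$ is a tuple $(G_0,G_1,\dots,G_q)$ of faces with $G_0\subseteq G_1\subseteq\cdots\subseteq G_q$. A $q$-Delannoy path is a lattice path from $(0,0)$ to $(m,n)$ using steps $(1,0)$, $(0,1)$, and diagonal steps $(1,1)$ each colored with one of $q$ colors. -}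

module Defs where

open import Data.Nat using (ℕ; zero; suc)
open import Data.Bool using (Bool; true)
open import Data.Fin using (Fin; inject₁; _<_) renaming (suc to fsuc)
open import Data.Vec using (Vec; lookup)
open import Data.Product using (_×_)
open import Relation.Binary.PropositionalEquality using (_≡_)

-- A set of edges {x_s, y_t} of E(X,Y), X = {x_0..x_{m-1}}, Y = {y_0..y_{n-1}}
-- (0-indexed), encoded as its characteristic m×n Boolean matrix.
EdgeSet : ℕ → ℕ → Set
EdgeSet m n = Vec (Vec Bool n) m

_∋[_,_] : ∀ {m n} → EdgeSet m n → Fin m → Fin n → Set
σ ∋[ s , t ] = lookup (lookup σ s) t ≡ true

IsFace : ∀ {m n} → EdgeSet m n → Set
IsFace {m} {n} σ =
  ∀ (s₁ s₂ : Fin m) (t₁ t₂ : Fin n) → σ ∋[ s₁ , t₁ ] → σ ∋[ s₂ , t₂ ] →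
    ((s₁ ≡ s₂ → t₁ ≡ t₂) × (t₁ ≡ t₂ → s₁ ≡ s₂)) × (s₁ < s₂ → t₁ < t₂)

_⊆ₑ_ : ∀ {m n} → EdgeSet m n → EdgeSet m n → Set
_⊆ₑ_ {m} {n} G H = ∀ (s : Fin m) (t : Fin n) → G ∋[ s , t ] → H ∋[ s , t ]

-- A (q+1)-flag (G_0 ⊆ G_1 ⊆ ... ⊆ G_q) of faces of Γ⁺(m,n).
-- The proof fields are irrelevant, so two flags are equal iff their
-- face sequences are equal.
record Flag (m n q : ℕ) : Set where
  constructor mkFlag
  field
    faces   : Vec (EdgeSet m n) (suc q)
    .isFace : ∀ (i : Fin (suc q)) → IsFace (lookup faces i)
    .chain  : ∀ (i : Fin q) → lookup faces (inject₁ i) ⊆ₑ lookup faces (fsuc i)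

data Delannoy (q : ℕ) : ℕ → ℕ → Set where
  start : Delannoy q zero zero
  east  : ∀ {m n} → Delannoy q m n → Delannoy q (suc m) n
  north : ∀ {m n} → Delannoy q m n → Delannoy q m (suc n)
  diag  : ∀ {m n} → Fin q → Delannoy q m n → Delannoy q (suc m) (suc n)

-- A flag G₀ ⊆ ⋯ ⊆ G_q is the same as the face G_q together with a label in
-- {0,…,q} on each of its edges: the first index i with the edge in G_i.
-- A labelled face is turned into a q-Delannoy path one step at a time, looking
-- at the corner (x₀, y₀): an edge of label c+1 there is a diagonal step of
-- colour c and an edge of label 0 an east step; with the corner empty, the step
-- is north if the column y₀ is empty and east otherwise (the face condition then
-- forces the row x₀ to be empty).  The two kinds of east step are told apart
-- afterwards by whether the remaining column y₀ is empty.
module Submission where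

open import Data.Bool using (Bool; true; false)
import Data.Bool.Properties as Bool
open import Data.Empty using (⊥; ⊥-elim)
open import Data.Fin using (Fin; zero; suc; inject₁; fromℕ; _<_)
import Data.Fin.Properties as Fin
open import Data.Maybe as Maybe using (Maybe; just; nothing; is-just)
import Data.Maybe.Properties as MaybeP
open import Data.Nat using (ℕ; zero; suc; z≤n; s≤s)
open import Data.Product using (Σ; _,_; _×_; proj₁; proj₂)
open import Data.Vec using (Vec; []; _∷_; lookup; map; tail; replicate; tabulate)
import Data.Vec.Properties as Vec
open import Function.Base using (case_of_)
open import Function.Bundles using (_⤖_; _↔_; mk↔ₛ′)
open import Function.Construct.Composition using (_↔-∘_)
open import Function.Properties.Inverse using (↔⇒⤖)
open import Relation.Binary.Definitions using (DecidableEquality)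
open import Relation.Binary.PropositionalEquality
open import Relation.Nullary.Decidable using (recompute)

open import Defs

data Comparison : Set where
  less equal greater : Comparison

compare : ∀ {k} → Fin k → Fin k → Comparison
compare zero    zero    = equal
compare zero    (suc _) = less
compare (suc _) zero    = greater
compare (suc i) (suc j) = compare i j

compare-refl : ∀ {k} (i : Fin k) → compare i i ≡ equal
compare-refl zero    = refl
compare-refl (suc i) = compare-refl i

compare≡equal⇒≡ : ∀ {k} (i j : Fin k) → compare i j ≡ equal → i ≡ j
compare≡equal⇒≡ zero    zero    _  = refl
compare≡equal⇒≡ zero    (suc _) ()
compare≡equal⇒≡ (suc _) zero    ()
compare≡equal⇒≡ (suc i) (suc j) eq = cong suc (compare≡equal⇒≡ i j eq)

compare≡less⇒< : ∀ {k} (i j : Fin k) → compare i j ≡ less → i < j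
compare≡less⇒< zero    zero    ()
compare≡less⇒< zero    (suc _) _  = s≤s z≤n
compare≡less⇒< (suc _) zero    ()
compare≡less⇒< (suc i) (suc j) eq = s≤s (compare≡less⇒< i j eq)

<⇒compare≡less : ∀ {k} (i j : Fin k) → i < j → compare i j ≡ less
<⇒compare≡less zero    (suc _) _         = refl
<⇒compare≡less (suc i) (suc j) (s≤s i<j) = <⇒compare≡less i j i<j

compare≡greater⇒> : ∀ {k} (i j : Fin k) → compare i j ≡ greater → j < i
compare≡greater⇒> zero    zero    ()
compare≡greater⇒> zero    (suc _) ()
compare≡greater⇒> (suc _) zero    _  = s≤s z≤n
compare≡greater⇒> (suc i) (suc j) eq = s≤s (compare≡greater⇒> i j eq)

>⇒compare≡greater : ∀ {k} (i j : Fin k) → j < i → compare i j ≡ greater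
>⇒compare≡greater (suc _) zero    _         = refl
>⇒compare≡greater (suc i) (suc j) (s≤s j<i) = >⇒compare≡greater i j j<i

Compatible : ∀ {m n} → Fin m → Fin m → Fin n → Fin n → Set
Compatible s₁ s₂ t₁ t₂ =
  ((s₁ ≡ s₂ → t₁ ≡ t₂) × (t₁ ≡ t₂ → s₁ ≡ s₂)) × (s₁ < s₂ → t₁ < t₂)

compare-≡⇒compatible : ∀ {m n} (s₁ s₂ : Fin m) (t₁ t₂ : Fin n) →
                       compare s₁ s₂ ≡ compare t₁ t₂ → Compatible s₁ s₂ t₁ t₂
compare-≡⇒compatible s₁ s₂ t₁ t₂ eq =
  ( (λ { refl → compare≡equal⇒≡ t₁ t₂ (trans (sym eq) (compare-refl s₁)) })
  , (λ { refl → compare≡equal⇒≡ s₁ s₂ (trans eq (compare-refl t₁)) }) )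
  , λ s₁<s₂ → compare≡less⇒< t₁ t₂ (trans (sym eq) (<⇒compare≡less s₁ s₂ s₁<s₂))

compatible⇒compare-≡ : ∀ {m n} (s₁ s₂ : Fin m) (t₁ t₂ : Fin n) →
                       Compatible s₁ s₂ t₁ t₂ → Compatible s₂ s₁ t₂ t₁ →
                       compare s₁ s₂ ≡ compare t₁ t₂
compatible⇒compare-≡ s₁ s₂ t₁ t₂ c₁₂ c₂₁ with compare s₁ s₂ in eq
... | equal with refl ← proj₁ (proj₁ c₁₂) (compare≡equal⇒≡ s₁ s₂ eq) =
  sym (compare-refl t₁)
... | less    = sym (<⇒compare≡less t₁ t₂ (proj₂ c₁₂ (compare≡less⇒< s₁ s₂ eq)))
... | greater = sym (>⇒compare≡greater t₁ t₂ (proj₂ c₂₁ (compare≡greater⇒> s₁ s₂ eq)))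

Matrix : Set → ℕ → ℕ → Set
Matrix A m n = Vec (Vec A n) m

entry : ∀ {A m n} → Matrix A m n → Fin m → Fin n → A
entry M s t = lookup (lookup M s) t

lookup-ext : ∀ {A : Set} {n} (u v : Vec A n) → (∀ i → lookup u i ≡ lookup v i) → u ≡ v
lookup-ext u v eq =
  trans (sym (Vec.tabulate∘lookup u)) (trans (Vec.tabulate-cong eq) (Vec.tabulate∘lookup v))

entry-ext : ∀ {A m n} (M N : Matrix A m n) → (∀ s t → entry M s t ≡ entry N s t) → M ≡ N
entry-ext M N eq = lookup-ext M N λ s → lookup-ext (lookup M s) (lookup N s) (eq s)

entry-tabulate : ∀ {A m n} (f : Fin m → Fin n → A) s t →
                 entry (tabulate λ s → tabulate (f s)) s t ≡ f s t
entry-tabulate f s t =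
  trans (cong (λ row → lookup row t) (Vec.lookup∘tabulate _ s)) (Vec.lookup∘tabulate (f s) t)

entry-map-tail : ∀ {A m n} (M : Matrix A m (suc n)) s t →
                 entry (map tail M) s t ≡ entry M s (suc t)
entry-map-tail ((_ ∷ _) ∷ _) zero    t = refl
entry-map-tail (_ ∷ M)       (suc s) t = entry-map-tail M s t

entry-map-∷ : ∀ {A m n} (x : A) (M : Matrix A m n) s t →
              entry (map (x ∷_) M) s t ≡ lookup (x ∷ lookup M s) t
entry-map-∷ x M s t = cong (λ row → lookup row t) (Vec.lookup-map s (x ∷_) M)

-- A monotone Boolean sequence b₀ ≤ b₁ ≤ ⋯ ≤ b_k is determined by the index
-- where it first becomes true, if any.
Monotone : ∀ {k} → Vec Bool (suc k) → Set
Monotone {k} v = ∀ (i : Fin k) → lookup v (inject₁ i) ≡ true → lookup v (suc i) ≡ true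

firstTrue : ∀ {k} → Vec Bool k → Maybe (Fin k)
firstTrue []          = nothing
firstTrue (true ∷ _)  = just zero
firstTrue (false ∷ v) = Maybe.map suc (firstTrue v)

reached : ∀ {k} → Maybe (Fin k) → Fin k → Bool
reached nothing        _       = false
reached (just zero)    _       = true
reached (just (suc j)) zero    = false
reached (just (suc j)) (suc i) = reached (just j) i

reached-map-suc : ∀ {k} (x : Maybe (Fin k)) i → reached (Maybe.map suc x) (suc i) ≡ reached x i
reached-map-suc nothing  _ = refl
reached-map-suc (just _) _ = refl

reached-monotone : ∀ {k} (x : Maybe (Fin (suc k))) i →
                   reached x (inject₁ i) ≡ true → reached x (suc i) ≡ true
reached-monotone (just zero)    _       _  = refl
reached-monotone (just (suc j)) (suc i) eq = reached-monotone (just j) i eq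

reached-fromℕ : ∀ {k} (x : Maybe (Fin (suc k))) → reached x (fromℕ k) ≡ is-just x
reached-fromℕ nothing              = refl
reached-fromℕ (just zero)          = refl
reached-fromℕ {suc k} (just (suc j)) = reached-fromℕ (just j)

reached⇒is-just : ∀ {k} (x : Maybe (Fin k)) i → reached x i ≡ true → is-just x ≡ true
reached⇒is-just (just _) _ _ = refl

firstTrue-reached : ∀ {k} (x : Maybe (Fin k)) → firstTrue (tabulate (reached x)) ≡ x
firstTrue-reached {zero}  nothing        = refl
firstTrue-reached {suc k} nothing        = cong (Maybe.map suc) (firstTrue-reached {k} nothing)
firstTrue-reached         (just zero)    = refl
firstTrue-reached         (just (suc j)) = cong (Maybe.map suc) (firstTrue-reached (just j))

monotone-from-true : ∀ {k} (v : Vec Bool (suc k)) → Monotone v → lookup v zero ≡ true →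
                     ∀ i → lookup v i ≡ true
monotone-from-true v       _    v₀ zero    = v₀
monotone-from-true {suc k} (_ ∷ w) mono v₀ (suc i) =
  monotone-from-true w (λ j → mono (suc j)) (mono zero v₀) i

reached-firstTrue : ∀ {k} (v : Vec Bool (suc k)) → Monotone v →
                    ∀ i → reached (firstTrue v) i ≡ lookup v i
reached-firstTrue (true ∷ w)  mono i = sym (monotone-from-true (true ∷ w) mono refl i)
reached-firstTrue (false ∷ w) mono zero with firstTrue w
... | nothing = refl
... | just _  = refl
reached-firstTrue {suc k} (false ∷ w) mono (suc i) =
  trans (reached-map-suc (firstTrue w) i) (reached-firstTrue w (λ j → mono (suc j)) i)

module _ {L : Set} where

  IsJust : Maybe L → Set
  IsJust x = is-just x ≡ true

  ≡nothing⇒¬IsJust : ∀ {x} → x ≡ nothing → IsJust x → ⊥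
  ≡nothing⇒¬IsJust refl ()

  Occupied : ∀ {m n} → Matrix (Maybe L) m n → Fin m → Fin n → Set
  Occupied A s t = IsJust (entry A s t)

  -- IsFace of the support, in the form of compare-≡⇒compatible.
  IsLabelledFace : ∀ {m n} → Matrix (Maybe L) m n → Set
  IsLabelledFace A = ∀ s₁ s₂ t₁ t₂ → Occupied A s₁ t₁ → Occupied A s₂ t₂ →
                     compare s₁ s₂ ≡ compare t₁ t₂

  emptyRow : ∀ {n} → Vec (Maybe L) n
  emptyRow = replicate _ nothing

  emptyRow-unoccupied : ∀ {n} (t : Fin n) → IsJust (lookup emptyRow t) → ⊥
  emptyRow-unoccupied t = ≡nothing⇒¬IsJust (Vec.lookup-replicate t nothing)

  consEmptyColumn : ∀ {m n} → Matrix (Maybe L) m n → Matrix (Maybe L) m (suc n)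
  consEmptyColumn = map (nothing ∷_)

  firstColumnEmpty : ∀ {m n} → Matrix (Maybe L) m (suc n) → Bool
  firstColumnEmpty []                   = true
  firstColumnEmpty ((nothing ∷ _) ∷ M) = firstColumnEmpty M
  firstColumnEmpty ((just _  ∷ _) ∷ M) = false

  map-tail-consEmptyColumn : ∀ {m n} (M : Matrix (Maybe L) m n) →
                             map tail (consEmptyColumn M) ≡ M
  map-tail-consEmptyColumn []      = refl
  map-tail-consEmptyColumn (r ∷ M) = cong (r ∷_) (map-tail-consEmptyColumn M)

  firstColumnEmpty-consEmptyColumn : ∀ {m n} (M : Matrix (Maybe L) m n) →
                                     firstColumnEmpty (consEmptyColumn M) ≡ true
  firstColumnEmpty-consEmptyColumn []      = refl
  firstColumnEmpty-consEmptyColumn (_ ∷ M) = firstColumnEmpty-consEmptyColumn M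

  firstColumnEmpty⇒consEmptyColumn-map-tail : ∀ {m n} (M : Matrix (Maybe L) m (suc n)) →
    firstColumnEmpty M ≡ true → consEmptyColumn (map tail M) ≡ M
  firstColumnEmpty⇒consEmptyColumn-map-tail []                  _  = refl
  firstColumnEmpty⇒consEmptyColumn-map-tail ((nothing ∷ r) ∷ M) eq =
    cong ((nothing ∷ r) ∷_) (firstColumnEmpty⇒consEmptyColumn-map-tail M eq)

  firstColumnEmpty⇒entry≡nothing : ∀ {m n} (M : Matrix (Maybe L) m (suc n)) →
    firstColumnEmpty M ≡ true → ∀ s → entry M s zero ≡ nothing
  firstColumnEmpty⇒entry≡nothing ((nothing ∷ _) ∷ M) _  zero    = refl
  firstColumnEmpty⇒entry≡nothing ((nothing ∷ _) ∷ M) eq (suc s) =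
    firstColumnEmpty⇒entry≡nothing M eq s

  unoccupied⇒firstColumnEmpty : ∀ {m n} (M : Matrix (Maybe L) m (suc n)) →
    (∀ s → Occupied M s zero → ⊥) → firstColumnEmpty M ≡ true
  unoccupied⇒firstColumnEmpty []                  _     = refl
  unoccupied⇒firstColumnEmpty ((nothing ∷ _) ∷ M) empty =
    unoccupied⇒firstColumnEmpty M (λ s → empty (suc s))
  unoccupied⇒firstColumnEmpty ((just _  ∷ _) ∷ M) empty = ⊥-elim (empty zero refl)

  firstColumnEmpty≡false⇒occupied : ∀ {m n} (M : Matrix (Maybe L) m (suc n)) →
    firstColumnEmpty M ≡ false → Σ (Fin m) λ s → Occupied M s zero
  firstColumnEmpty≡false⇒occupied ((nothing ∷ _) ∷ M) eq
    with s , occ ← firstColumnEmpty≡false⇒occupied M eq = suc s , occ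
  firstColumnEmpty≡false⇒occupied ((just _ ∷ _) ∷ M) _ = zero , refl

  unoccupied⇒emptyRow : ∀ {n} (r : Vec (Maybe L) n) →
                        (∀ t → IsJust (lookup r t) → ⊥) → r ≡ emptyRow
  unoccupied⇒emptyRow []            _     = refl
  unoccupied⇒emptyRow (nothing ∷ r) empty =
    cong (nothing ∷_) (unoccupied⇒emptyRow r (λ t → empty (suc t)))
  unoccupied⇒emptyRow (just _  ∷ r) empty = ⊥-elim (empty zero refl)

  isLabelledFace-tail : ∀ {m n} {r} {M : Matrix (Maybe L) m n} →
                        IsLabelledFace (r ∷ M) → IsLabelledFace M
  isLabelledFace-tail face s₁ s₂ = face (suc s₁) (suc s₂)

  isLabelledFace-map-tail : ∀ {m n} (M : Matrix (Maybe L) m (suc n)) →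
                            IsLabelledFace M → IsLabelledFace (map tail M)
  isLabelledFace-map-tail M face s₁ s₂ t₁ t₂ occ₁ occ₂ =
    face s₁ s₂ (suc t₁) (suc t₂) (subst IsJust (entry-map-tail M s₁ t₁) occ₁)
                                 (subst IsJust (entry-map-tail M s₂ t₂) occ₂)

  isLabelledFace-consEmptyColumn : ∀ {m n} (M : Matrix (Maybe L) m n) →
                                   IsLabelledFace M → IsLabelledFace (consEmptyColumn M)
  isLabelledFace-consEmptyColumn M face s₁ s₂ zero t₂ occ₁ occ₂ =
    ⊥-elim (≡nothing⇒¬IsJust (entry-map-∷ nothing M s₁ zero) occ₁)
  isLabelledFace-consEmptyColumn M face s₁ s₂ (suc t₁) zero occ₁ occ₂ =
    ⊥-elim (≡nothing⇒¬IsJust (entry-map-∷ nothing M s₂ zero) occ₂)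
  isLabelledFace-consEmptyColumn M face s₁ s₂ (suc t₁) (suc t₂) occ₁ occ₂ =
    face s₁ s₂ t₁ t₂ (subst IsJust (entry-map-∷ nothing M s₁ (suc t₁)) occ₁)
                     (subst IsJust (entry-map-∷ nothing M s₂ (suc t₂)) occ₂)

  isLabelledFace-consEmptyRow : ∀ {m n} {M : Matrix (Maybe L) m n} →
                                IsLabelledFace M → IsLabelledFace (emptyRow ∷ M)
  isLabelledFace-consEmptyRow face zero     _        t₁ _  occ₁ _    =
    ⊥-elim (emptyRow-unoccupied t₁ occ₁)
  isLabelledFace-consEmptyRow face (suc s₁) zero     _  t₂ _    occ₂ =
    ⊥-elim (emptyRow-unoccupied t₂ occ₂)
  isLabelledFace-consEmptyRow face (suc s₁) (suc s₂) t₁ t₂ occ₁ occ₂ = face s₁ s₂ t₁ t₂ occ₁ occ₂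

  isLabelledFace-consCorner : ∀ {m n} {l} {M : Matrix (Maybe L) m (suc n)} →
    IsLabelledFace M → firstColumnEmpty M ≡ true → IsLabelledFace ((just l ∷ emptyRow) ∷ M)
  isLabelledFace-consCorner {M = M} face empty = go
    where
    column-empty : ∀ s → Occupied M s zero → ⊥
    column-empty s = ≡nothing⇒¬IsJust (firstColumnEmpty⇒entry≡nothing M empty s)

    go : IsLabelledFace ((just _ ∷ emptyRow) ∷ M)
    go zero     zero     zero     zero     _    _    = refl
    go zero     _        (suc t₁) _        occ₁ _    = ⊥-elim (emptyRow-unoccupied t₁ occ₁)
    go _        zero     _        (suc t₂) _    occ₂ = ⊥-elim (emptyRow-unoccupied t₂ occ₂)
    go (suc s₁) _        zero     _        occ₁ _    = ⊥-elim (column-empty s₁ occ₁)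
    go _        (suc s₂) _        zero     _    occ₂ = ⊥-elim (column-empty s₂ occ₂)
    go zero     (suc s₂) zero     (suc t₂) _    _    = refl
    go (suc s₁) zero     (suc t₁) zero     _    _    = refl
    go (suc s₁) (suc s₂) (suc t₁) (suc t₂) occ₁ occ₂ = face s₁ s₂ (suc t₁) (suc t₂) occ₁ occ₂

  occupiedCorner⇒firstRowEmpty : ∀ {m n} {l r} {M : Matrix (Maybe L) m (suc n)} →
    IsLabelledFace ((just l ∷ r) ∷ M) → r ≡ emptyRow
  occupiedCorner⇒firstRowEmpty {r = r} face = unoccupied⇒emptyRow r λ t occ →
    case face zero zero zero (suc t) refl occ of λ ()

  occupiedCorner⇒firstColumnEmpty : ∀ {m n} {l r} {M : Matrix (Maybe L) m (suc n)} →
    IsLabelledFace ((just l ∷ r) ∷ M) → firstColumnEmpty M ≡ true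
  occupiedCorner⇒firstColumnEmpty {M = M} face = unoccupied⇒firstColumnEmpty M λ s occ →
    case face zero (suc s) zero zero refl occ of λ ()

  occupiedColumn⇒firstRowEmpty : ∀ {m n} {x r} {M : Matrix (Maybe L) m (suc n)} →
    IsLabelledFace ((x ∷ r) ∷ M) → firstColumnEmpty M ≡ false → r ≡ emptyRow
  occupiedColumn⇒firstRowEmpty {r = r} {M} face nonempty
    with s , occ ← firstColumnEmpty≡false⇒occupied M nonempty =
    unoccupied⇒emptyRow r λ t occ′ → case face zero (suc s) (suc t) zero occ′ occ of λ ()

-- Entry (s, t) is the label in {0,…,q} of the edge {x_s, y_t}, or nothing if
-- the edge is absent.  Row x₀ and column y₀ correspond to the last step of the
-- path, which is where toPath and fromPath work.
Labelling : ℕ → ℕ → ℕ → Set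
Labelling q = Matrix (Maybe (Fin (suc q)))

module _ {q : ℕ} where

  eastRow : ∀ {n} → Bool → Vec (Maybe (Fin (suc q))) (suc n)
  eastRow true  = just zero ∷ emptyRow
  eastRow false = emptyRow

  toPath : ∀ {m n} → Labelling q m n → Delannoy q m n
  toPath {zero}  {zero}  []                       = start
  toPath {zero}  {suc n} M                        = north (toPath (map tail M))
  toPath {suc m} {zero}  (_ ∷ M)                  = east (toPath M)
  toPath {suc m} {suc n} ((just (suc c) ∷ _) ∷ M) = diag c (toPath (map tail M))
  toPath {suc m} {suc n} ((just zero ∷ _) ∷ M)    = east (toPath M)
  toPath {suc m} {suc n} ((nothing ∷ r) ∷ M) with firstColumnEmpty M
  ... | true  = north (toPath (map tail ((nothing ∷ r) ∷ M)))
  ... | false = east (toPath M)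

  fromPath : ∀ {m n} → Delannoy q m n → Labelling q m n
  fromPath start                = []
  fromPath (north p)            = consEmptyColumn (fromPath p)
  fromPath (diag c p)           = (just (suc c) ∷ emptyRow) ∷ consEmptyColumn (fromPath p)
  fromPath (east {n = zero} p)  = [] ∷ fromPath p
  fromPath (east {n = suc n} p) = eastRow (firstColumnEmpty (fromPath p)) ∷ fromPath p

  toPath-consEmptyColumn : ∀ {m n} (M : Labelling q m n) →
                           toPath (consEmptyColumn M) ≡ north (toPath M)
  toPath-consEmptyColumn {zero}  []      = refl
  toPath-consEmptyColumn {suc m} (r ∷ M)
    rewrite firstColumnEmpty-consEmptyColumn M | map-tail-consEmptyColumn M = refl

  toPath-fromPath : ∀ {m n} (p : Delannoy q m n) → toPath (fromPath p) ≡ p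
  toPath-fromPath start = refl
  toPath-fromPath (north p) =
    trans (toPath-consEmptyColumn (fromPath p)) (cong north (toPath-fromPath p))
  toPath-fromPath (diag c p)
    rewrite map-tail-consEmptyColumn (fromPath p) = cong (diag c) (toPath-fromPath p)
  toPath-fromPath (east {n = zero} p) = cong east (toPath-fromPath p)
  toPath-fromPath (east {n = suc n} p) with firstColumnEmpty (fromPath p) in eq
  ... | true  = cong east (toPath-fromPath p)
  ... | false rewrite eq = cong east (toPath-fromPath p)

  fromPath-isLabelledFace : ∀ {m n} (p : Delannoy q m n) → IsLabelledFace (fromPath p)
  fromPath-isLabelledFace start ()
  fromPath-isLabelledFace (north p) =
    isLabelledFace-consEmptyColumn (fromPath p) (fromPath-isLabelledFace p)
  fromPath-isLabelledFace (diag c p) =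
    isLabelledFace-consCorner
      (isLabelledFace-consEmptyColumn (fromPath p) (fromPath-isLabelledFace p))
      (firstColumnEmpty-consEmptyColumn (fromPath p))
  fromPath-isLabelledFace (east {n = zero} p) _ _ ()
  fromPath-isLabelledFace (east {n = suc n} p) with firstColumnEmpty (fromPath p) in eq
  ... | true  = isLabelledFace-consCorner (fromPath-isLabelledFace p) eq
  ... | false = isLabelledFace-consEmptyRow (fromPath-isLabelledFace p)

  fromPath-toPath : ∀ {m n} (M : Labelling q m n) → IsLabelledFace M → fromPath (toPath M) ≡ M
  fromPath-toPath-map-tail : ∀ {m n} (M : Labelling q m (suc n)) → IsLabelledFace M →
    firstColumnEmpty M ≡ true → consEmptyColumn (fromPath (toPath (map tail M))) ≡ M

  fromPath-toPath {zero}  {zero}  []       _    = refl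
  fromPath-toPath {zero}  {suc n} []       _    = fromPath-toPath-map-tail [] (λ ()) refl
  fromPath-toPath {suc m} {zero}  ([] ∷ M) face =
    cong ([] ∷_) (fromPath-toPath M (isLabelledFace-tail face))
  fromPath-toPath {suc m} {suc n} ((just (suc c) ∷ r) ∷ M) face =
    cong₂ (λ r′ M′ → (just (suc c) ∷ r′) ∷ M′)
      (sym (occupiedCorner⇒firstRowEmpty face))
      (fromPath-toPath-map-tail M (isLabelledFace-tail face) (occupiedCorner⇒firstColumnEmpty face))
  fromPath-toPath {suc m} {suc n} ((just zero ∷ r) ∷ M) face
    rewrite fromPath-toPath M (isLabelledFace-tail face) | occupiedCorner⇒firstColumnEmpty face =
    cong (λ r′ → (just zero ∷ r′) ∷ M) (sym (occupiedCorner⇒firstRowEmpty face))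
  fromPath-toPath {suc m} {suc n} ((nothing ∷ r) ∷ M) face with firstColumnEmpty M in eq
  ... | true  = fromPath-toPath-map-tail ((nothing ∷ r) ∷ M) face eq
  ... | false rewrite fromPath-toPath M (isLabelledFace-tail face) | eq =
    cong (λ r′ → (nothing ∷ r′) ∷ M) (sym (occupiedColumn⇒firstRowEmpty face eq))

  fromPath-toPath-map-tail M face empty =
    trans (cong consEmptyColumn (fromPath-toPath (map tail M) (isLabelledFace-map-tail M face)))
          (firstColumnEmpty⇒consEmptyColumn-map-tail M empty)

record LabelledFace (q m n : ℕ) : Set where
  constructor mkLabelledFace
  field
    labelling       : Labelling q m n
    .isLabelledFace : IsLabelledFace labelling

labelling-injective : ∀ {q m n} {A B : LabelledFace q m n} →
                      LabelledFace.labelling A ≡ LabelledFace.labelling B → A ≡ B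
labelling-injective {A = mkLabelledFace _ _} {mkLabelledFace _ _} refl = refl

faces-injective : ∀ {m n q} {F G : Flag m n q} → Flag.faces F ≡ Flag.faces G → F ≡ G
faces-injective {F = mkFlag _ _ _} {mkFlag _ _ _} refl = refl

-- The face conditions are irrelevant fields, so equalities derived from them
-- are irrelevant too; decidable equality of the carriers recomputes them.
_≟-labelling_ : ∀ {q m n} → DecidableEquality (Labelling q m n)
_≟-labelling_ = Vec.≡-dec (Vec.≡-dec (MaybeP.≡-dec Fin._≟_))

_≟-faces_ : ∀ {m n q} → DecidableEquality (Vec (EdgeSet m n) q)
_≟-faces_ = Vec.≡-dec (Vec.≡-dec (Vec.≡-dec Bool._≟_))

labelledFace↔delannoy : ∀ {q m n} → LabelledFace q m n ↔ Delannoy q m n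
labelledFace↔delannoy = mk↔ₛ′
  (λ A → toPath (LabelledFace.labelling A))
  (λ p → mkLabelledFace (fromPath p) (fromPath-isLabelledFace p))
  toPath-fromPath
  λ { (mkLabelledFace A face) → labelling-injective
        (recompute (fromPath (toPath A) ≟-labelling A) (fromPath-toPath A face)) }

module _ {m n q : ℕ} where

  IsChain : Vec (EdgeSet m n) (suc q) → Set
  IsChain G = ∀ (i : Fin q) → lookup G (inject₁ i) ⊆ₑ lookup G (suc i)

  levelVector : Vec (EdgeSet m n) (suc q) → Fin m → Fin n → Vec Bool (suc q)
  levelVector G s t = tabulate λ i → entry (lookup G i) s t

  labellingOf : Vec (EdgeSet m n) (suc q) → Labelling q m n
  labellingOf G = tabulate λ s → tabulate λ t → firstTrue (levelVector G s t)

  sublevel : Labelling q m n → Fin (suc q) → EdgeSet m n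
  sublevel A i = tabulate λ s → tabulate λ t → reached (entry A s t) i

  facesOf : Labelling q m n → Vec (EdgeSet m n) (suc q)
  facesOf A = tabulate (sublevel A)

  entry-facesOf : ∀ A i s t → entry (lookup (facesOf A) i) s t ≡ reached (entry A s t) i
  entry-facesOf A i s t =
    trans (cong (λ M → entry M s t) (Vec.lookup∘tabulate (sublevel A) i))
          (entry-tabulate (λ s t → reached (entry A s t) i) s t)

  lookup-levelVector : ∀ G i s t → lookup (levelVector G s t) i ≡ entry (lookup G i) s t
  lookup-levelVector G i s t = Vec.lookup∘tabulate (λ i → entry (lookup G i) s t) i

  levelVector-monotone : ∀ G → IsChain G → ∀ s t → Monotone (levelVector G s t)
  levelVector-monotone G chain s t i G∋ =
    trans (lookup-levelVector G (suc i) s t)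
          (chain i s t (trans (sym (lookup-levelVector G (inject₁ i) s t)) G∋))

  reached-labellingOf : ∀ G → IsChain G → ∀ i s t →
                        reached (entry (labellingOf G) s t) i ≡ entry (lookup G i) s t
  reached-labellingOf G chain i s t = begin
    reached (entry (labellingOf G) s t) i
      ≡⟨ cong (λ x → reached x i) (entry-tabulate _ s t) ⟩
    reached (firstTrue (levelVector G s t)) i
      ≡⟨ reached-firstTrue (levelVector G s t) (levelVector-monotone G chain s t) i ⟩
    lookup (levelVector G s t) i
      ≡⟨ lookup-levelVector G i s t ⟩
    entry (lookup G i) s t
      ∎
    where open ≡-Reasoning

  labellingOf-facesOf : ∀ A → labellingOf (facesOf A) ≡ A
  labellingOf-facesOf A = entry-ext _ A λ s t → begin
    entry (labellingOf (facesOf A)) s t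
      ≡⟨ entry-tabulate _ s t ⟩
    firstTrue (levelVector (facesOf A) s t)
      ≡⟨ cong firstTrue (Vec.tabulate-cong (λ i → entry-facesOf A i s t)) ⟩
    firstTrue (tabulate (reached (entry A s t)))
      ≡⟨ firstTrue-reached (entry A s t) ⟩
    entry A s t
      ∎
    where open ≡-Reasoning

  facesOf-labellingOf : ∀ G → IsChain G → facesOf (labellingOf G) ≡ G
  facesOf-labellingOf G chain = lookup-ext _ G λ i → entry-ext _ (lookup G i) λ s t →
    trans (entry-facesOf (labellingOf G) i s t) (reached-labellingOf G chain i s t)

  -- The support of the labelling is the last face G_q.
  labellingOf-isLabelledFace : ∀ G → IsFace (lookup G (fromℕ q)) → IsChain G →
                               IsLabelledFace (labellingOf G)
  labellingOf-isLabelledFace G face chain s₁ s₂ t₁ t₂ occ₁ occ₂ =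
    compatible⇒compare-≡ s₁ s₂ t₁ t₂
      (face s₁ s₂ t₁ t₂ (inLast s₁ t₁ occ₁) (inLast s₂ t₂ occ₂))
      (face s₂ s₁ t₂ t₁ (inLast s₂ t₂ occ₂) (inLast s₁ t₁ occ₁))
    where
    inLast : ∀ s t → Occupied (labellingOf G) s t → lookup G (fromℕ q) ∋[ s , t ]
    inLast s t occ = trans (sym (reached-labellingOf G chain (fromℕ q) s t))
                           (trans (reached-fromℕ (entry (labellingOf G) s t)) occ)

  facesOf-isFace : ∀ A → IsLabelledFace A → ∀ i → IsFace (lookup (facesOf A) i)
  facesOf-isFace A face i s₁ s₂ t₁ t₂ in₁ in₂ =
    compare-≡⇒compatible s₁ s₂ t₁ t₂ (face s₁ s₂ t₁ t₂ (occupied s₁ t₁ in₁) (occupied s₂ t₂ in₂))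
    where
    occupied : ∀ s t → lookup (facesOf A) i ∋[ s , t ] → Occupied A s t
    occupied s t G∋ = reached⇒is-just (entry A s t) i (trans (sym (entry-facesOf A i s t)) G∋)

  facesOf-isChain : ∀ A → IsChain (facesOf A)
  facesOf-isChain A i s t G∋ =
    trans (entry-facesOf A (suc i) s t)
          (reached-monotone (entry A s t) i (trans (sym (entry-facesOf A (inject₁ i) s t)) G∋))

  toLabelledFace : Flag m n q → LabelledFace q m n
  toLabelledFace (mkFlag G face chain) =
    mkLabelledFace (labellingOf G) (labellingOf-isLabelledFace G (face (fromℕ q)) chain)

  toFlag : LabelledFace q m n → Flag m n q
  toFlag (mkLabelledFace A face) = mkFlag (facesOf A) (facesOf-isFace A face) (facesOf-isChain A)

  flag↔labelledFace : Flag m n q ↔ LabelledFace q m n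
  flag↔labelledFace = mk↔ₛ′ toLabelledFace toFlag
    (λ A → labelling-injective (labellingOf-facesOf (LabelledFace.labelling A)))
    λ { (mkFlag G face chain) → faces-injective
          (recompute (facesOf (labellingOf G) ≟-faces G) (facesOf-labellingOf G chain)) }

proposition3p25 : (m n q : ℕ) → Flag m n q ⤖ Delannoy q m n
proposition3p25 m n q = ↔⇒⤖ (labelledFace↔delannoy ↔-∘ flag↔labelledFace)
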